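{- Consider permutation routing on half-duplex triangular grids in the store-and-forward $\Delta$-port model. Then: (i) there is a routing algorithm using shortest paths which, for every permutation routing instance on a network that is a convex subgraph of the infinite triangular grid, delivers all packets within at most $2\ell_{\max}$ steps, where $\ell_{\max}$ is the maximum, over all packets, of the distance between the packet's origin and its destination; (ii) this is tight: for every positive integer $\ell_{\max}$ there is a permutation routing instance on the half-duplex infinite triangular grid, with maximum origin–destination distance $\ell_{\max}$, for which every schedule that routes each packet along a shortest path needs at least $2\ell_{\max}$ steps; (iii) consequently, on every instance the algorithm's running time is at most twice the minimum possible running time (it is a 2-approximation algorithm).
   Context: Triangular grid: the infinite graph with vertex set $\mathbb{Z}^2$ in which $(x,y)$ is adjacent to $(x\pm1,y)$, $(x,y\pm1)$ and $\pm(1,1)+(x,y)$ (equivalently, vertices are integer combinations of unit vectors $\mathbf i,\mathbf j,\mathbf k$ at $120^\circ$ with $\mathbf i+\mathbf j+\mathbf k=0$, and each vertex is adjacent to its translates by $\pm\mathbf i,\pm\mathbf j,\pm\mathbf k$). A convex subgraph is a subgraph containing, for any two of its vertices, all shortest paths of the grid between them. Routing model: a set of packets is given, each with an origin and a destination node. Time proceeds in synchronous steps; in each step each packet either stays at its current node (nodes have unbounded queues) or moves along one incident edge; a node may use all its incident edges simultaneously ($\Delta$-port). Half-duplex: each edge can be traversed by at most one packet per step (in either direction). The running time is the number of steps until all packets have reached their destinations. Permutation routing: every node is the origin of at most one packet and the destination of at most one packet. -}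

module Defs where

open import Data.Nat using (ℕ; zero; suc; _≤_; _<_; _*_)
open import Data.Integer using (ℤ; +_; -[1+_]) renaming (_+_ to _+ℤ_)
open import Data.Fin using (Fin)
open import Data.Unit using (⊤)
open import Data.Product using (Σ; ∃; ∃-syntax; _×_; _,_)
open import Data.Sum using (_⊎_)
open import Data.List using (List; []; _∷_)
open import Data.List.Relation.Unary.All using (All)
open import Relation.Nullary using (¬_)
open import Relation.Binary.PropositionalEquality using (_≡_; _≢_)
open import Function.Definitions using (Injective)

-- The infinite triangular grid: vertex set ℤ², (x,y) adjacent to
-- (x±1,y), (x,y±1), (x±1,y±1) (same sign).

V : Set
V = ℤ × ℤ

data Dir : Set where
  +i -i +j -j +k -k : Dir

δ : Dir → V
δ +i = (+ 1 , + 0)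
δ -i = (-[1+ 0 ] , + 0)
δ +j = (+ 0 , + 1)
δ -j = (+ 0 , -[1+ 0 ])
δ +k = (+ 1 , + 1)
δ -k = (-[1+ 0 ] , -[1+ 0 ])

_⊕_ : V → V → V
(a , b) ⊕ (c , d) = (a +ℤ c , b +ℤ d)

Adj : V → V → Set
Adj u v = ∃[ d ] (v ≡ u ⊕ δ d)

data Walk : V → V → ℕ → Set where
  nil  : ∀ {u} → Walk u u 0
  cons : ∀ {u v w n} → Adj u v → Walk v w n → Walk u w (suc n)

walkVerts : ∀ {u v n} → Walk u v n → List V
walkVerts {u} nil = u ∷ []
walkVerts {u} (cons _ w) = u ∷ walkVerts w

Dist : V → V → ℕ → Set
Dist u v n = Walk u v n × (∀ m → m < n → ¬ Walk u v m)

ShortestPath : ∀ {u v n} → Walk u v n → Set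
ShortestPath {u} {v} {n} _ = Dist u v n

-- Networks: subgraphs given by a vertex set S (edges: grid edges inside S).
-- Convexity: every shortest grid path between vertices of S lies in S
-- (so the subgraph is automatically the induced one).

Convex : (V → Set) → Set
Convex S = ∀ {u v n} (w : Walk u v n) → S u → S v → ShortestPath w → All S (walkVerts w)

FullGrid : V → Set
FullGrid _ = ⊤

record Instance (k : ℕ) : Set where
  field
    origin : Fin k → V
    dest   : Fin k → V
open Instance public

IsPermutation : (V → Set) → ∀ {k} → Instance k → Set
IsPermutation S I =
  Injective _≡_ _≡_ (origin I) × Injective _≡_ _≡_ (dest I) ×
  (∀ i → S (origin I i)) × (∀ i → S (dest I i))

DistBoundedBy : ∀ {k} → Instance k → ℕ → Set
DistBoundedBy I L = ∀ i n → Dist (origin I i) (dest I i) n → n ≤ L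

MaxDist : ∀ {k} → Instance k → ℕ → Set
MaxDist I L = DistBoundedBy I L × ∃[ i ] Dist (origin I i) (dest I i) L

-- A schedule: position of packet i at time t.
Schedule : ℕ → Set
Schedule k = Fin k → ℕ → V

SameEdge : V → V → V → V → Set
SameEdge a b c d = (a ≡ c × b ≡ d) ⊎ (a ≡ d × b ≡ c)

-- Valid store-and-forward, Δ-port, half-duplex schedule on network S
-- delivering all packets by time T.
ValidSchedule : (V → Set) → ∀ {k} → Instance k → Schedule k → ℕ → Set
ValidSchedule S {k} I p T =
  (∀ i → p i 0 ≡ origin I i) ×
  (∀ i t → S (p i t)) ×
  (∀ i t → p i (suc t) ≡ p i t ⊎ Adj (p i t) (p i (suc t))) ×
  (∀ i j t → i ≢ j → Adj (p i t) (p i (suc t)) → Adj (p j t) (p j (suc t)) →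
     ¬ SameEdge (p i t) (p i (suc t)) (p j t) (p j (suc t))) ×
  (∀ i → p i T ≡ dest I i)

-- Every packet is routed along a shortest path: each move goes to a
-- neighbour strictly closer (by one) to the packet's destination.
ShortestPathRouting : ∀ {k} → Instance k → Schedule k → Set
ShortestPathRouting I p =
  ∀ i t → p i (suc t) ≡ p i t ⊎
          (Adj (p i t) (p i (suc t)) ×
           ∃[ n ] (Dist (p i (suc t)) (dest I i) n × Dist (p i t) (dest I i) (suc n)))

Algorithm : Set₁
Algorithm = (S : V → Set) → Convex S → ∀ k → (I : Instance k) → IsPermutation S I →
  Σ ℕ λ T → Σ (Schedule k) λ p → ValidSchedule S I p T × ShortestPathRouting I p

runTime : Algorithm → (S : V → Set) → (c : Convex S) → ∀ k → (I : Instance k) → IsPermutation S I → ℕ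
runTime A S c k I h with A S c k I h
... | (T , _) = T

module Submission where

-- Distances are certified by linear functionals f with f(δ d) ≤ 1 for all
-- six directions: along a walk such an f grows by at most the length, so a
-- walk on which it grows by exactly the length is shortest.  Every
-- displacement splits, in one of six sectors, as a·s + b·e with s an "early"
-- direction (+i, +j, -k) and e a "late" one (+k, -i, -j); the route "a steps
-- along s, then b steps along e" is certified shortest.
--
-- (i) Time is cut into ℓmax rounds of two steps, the even step for positive
-- directions and the odd one for negative directions.  A packet takes its
-- early leg in the first a rounds and its late leg in the last b rounds.
-- Two packets meeting on an edge would move in the same direction in the
-- same round (then they share an origin or a destination) or in opposite
-- directions (impossible: these own different steps).  Convexity keeps all
-- packets inside the network.  (iii) Every schedule needs ℓmax steps.
-- (ii) On the x-axis, 2ℓ packets of length ℓ must all cross the middle edge,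
-- one per step.

open import Defs
open import Data.Bool using (Bool; true; false; not)
open import Data.Bool.Properties using (not-¬)
open import Data.Empty using (⊥; ⊥-elim)
open import Data.Fin as Fin using (Fin; zero; suc; toℕ; splitAt; fromℕ<)
import Data.Fin.Properties as FinP
open import Data.Integer as ℤ using (ℤ; +_; -[1+_]; +≤+)
  renaming (_+_ to _+ℤ_; _*_ to _*ℤ_; _-_ to _-ℤ_; _≤_ to _≤ℤ_; _≤?_ to _≤ℤ?_)
import Data.Integer.Properties as ℤP
open import Data.Integer.Tactic.RingSolver using (solve-∀)
open import Algebra.Properties.AbelianGroup ℤP.+-0-abelianGroup using (∙-cancelˡ; ∙-cancelʳ)
open import Data.List.Relation.Unary.All using (All; []; _∷_)
open import Data.Nat as ℕ
  using (ℕ; zero; suc; _+_; _∸_; _*_; _⊓_; _⊔_; _≤_; _<_; z≤n; s≤s; ⌊_/2⌋; ⌈_/2⌉)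
import Data.Nat.Properties as ℕP
open import Data.Product using (Σ; ∃-syntax; _×_; _,_; proj₁; proj₂)
open import Data.Sum using (_⊎_; inj₁; inj₂; map₂)
open import Data.Unit using (tt)
open import Function using (_∘_)
open import Relation.Nullary using (¬_; Dec; yes; no)
open import Relation.Nullary.Decidable using (from-yes; map′; _×-dec_)
open import Relation.Binary.PropositionalEquality

𝟎 : V
𝟎 = (+ 0 , + 0)

infixr 25 _·_

_·_ : ℕ → V → V
n · (x , y) = (+ n *ℤ x , + n *ℤ y)

_⊖_ : V → V → V
(a , b) ⊖ (c , d) = (a -ℤ c , b -ℤ d)

⊕-assoc : ∀ u v w → (u ⊕ v) ⊕ w ≡ u ⊕ (v ⊕ w)
⊕-assoc (a , b) (c , d) (e , f) = cong₂ _,_ (ℤP.+-assoc a c e) (ℤP.+-assoc b d f)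

⊕-identityʳ : ∀ u → u ⊕ 𝟎 ≡ u
⊕-identityʳ (a , b) = cong₂ _,_ (ℤP.+-identityʳ a) (ℤP.+-identityʳ b)

⊕-cancelˡ : ∀ u {v w} → u ⊕ v ≡ u ⊕ w → v ≡ w
⊕-cancelˡ (a , b) {c , d} {e , f} eq =
  cong₂ _,_ (∙-cancelˡ a c e (cong proj₁ eq)) (∙-cancelˡ b d f (cong proj₂ eq))

⊕-cancelʳ : ∀ w {u v} → u ⊕ w ≡ v ⊕ w → u ≡ v
⊕-cancelʳ (a , b) {c , d} {e , f} eq =
  cong₂ _,_ (∙-cancelʳ a c e (cong proj₁ eq)) (∙-cancelʳ b d f (cong proj₂ eq))

⊕-⊖ : ∀ u v → u ⊕ (v ⊖ u) ≡ v
⊕-⊖ (a , b) (c , d) = cong₂ _,_ (cancel a c) (cancel b d)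
  where
  cancel : ∀ a c → a +ℤ (c -ℤ a) ≡ c
  cancel = solve-∀

·-zero : ∀ w → 0 · w ≡ 𝟎
·-zero (p , q) = cong₂ _,_ (ℤP.*-zeroˡ p) (ℤP.*-zeroˡ q)

·-suc : ∀ n w → suc n · w ≡ w ⊕ n · w
·-suc n (p , q) = cong₂ _,_ (suc* (+ n) p) (suc* (+ n) q)
  where
  suc* : ∀ N p → (+ 1 +ℤ N) *ℤ p ≡ p +ℤ N *ℤ p
  suc* = solve-∀

direction-of : V → Dir
direction-of (+ 1 , + 0) = +i
direction-of (-[1+ 0 ] , + 0) = -i
direction-of (+ 0 , + 1) = +j
direction-of (+ 0 , -[1+ 0 ]) = -j
direction-of (+ 1 , + 1) = +k
direction-of _ = -k

δ-injective : ∀ {d d′} → δ d ≡ δ d′ → d ≡ d′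
δ-injective {d} {d′} eq = trans (sym (left-inverse d)) (trans (cong direction-of eq) (left-inverse d′))
  where
  left-inverse : ∀ d → direction-of (δ d) ≡ d
  left-inverse +i = refl
  left-inverse -i = refl
  left-inverse +j = refl
  left-inverse -j = refl
  left-inverse +k = refl
  left-inverse -k = refl

δ-nonzero : ∀ d → δ d ≢ 𝟎
δ-nonzero +i ()
δ-nonzero -i ()
δ-nonzero +j ()
δ-nonzero -j ()
δ-nonzero +k ()
δ-nonzero -k ()

adj-irreflexive : ∀ u → ¬ Adj u u
adj-irreflexive u (d , loop) =
  δ-nonzero d (⊕-cancelˡ u (trans (sym loop) (sym (⊕-identityʳ u))))

reverse : Dir → Dir
reverse +i = -i
reverse -i = +i
reverse +j = -j
reverse -j = +j
reverse +k = -k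
reverse -k = +k

δ-reverse : ∀ d → δ d ⊕ δ (reverse d) ≡ 𝟎
δ-reverse +i = refl
δ-reverse -i = refl
δ-reverse +j = refl
δ-reverse -j = refl
δ-reverse +k = refl
δ-reverse -k = refl

mv : V → Dir → ℕ → V
mv u d zero = u
mv u d (suc n) = mv (u ⊕ δ d) d n

mv-+ : ∀ u d m n → mv (mv u d m) d n ≡ mv u d (m + n)
mv-+ u d zero n = refl
mv-+ u d (suc m) n = mv-+ (u ⊕ δ d) d m n

mv-suc : ∀ u d n → mv u d (suc n) ≡ mv u d n ⊕ δ d
mv-suc u d n = trans (cong (mv u d) (ℕP.+-comm 1 n)) (sym (mv-+ u d n 1))

mv-closed : ∀ u d n → mv u d n ≡ u ⊕ n · δ d
mv-closed u d zero = sym (trans (cong (u ⊕_) (·-zero (δ d))) (⊕-identityʳ u))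
mv-closed u d (suc n) = begin
  mv (u ⊕ δ d) d n       ≡⟨ mv-closed (u ⊕ δ d) d n ⟩
  (u ⊕ δ d) ⊕ n · δ d    ≡⟨ ⊕-assoc u (δ d) (n · δ d) ⟩
  u ⊕ (δ d ⊕ n · δ d)    ≡⟨ cong (u ⊕_) (sym (·-suc n (δ d))) ⟩
  u ⊕ suc n · δ d        ∎
  where open ≡-Reasoning

mv-cancel : ∀ {u u′} d n → mv u d n ≡ mv u′ d n → u ≡ u′
mv-cancel {u} {u′} d n eq =
  ⊕-cancelʳ (n · δ d) (trans (sym (mv-closed u d n)) (trans eq (mv-closed u′ d n)))

line : ∀ u d n → Walk u (mv u d n) n
line u d zero = nil
line u d (suc n) = cons (d , refl) (line (u ⊕ δ d) d n)

_++ʷ_ : ∀ {u v w m n} → Walk u v m → Walk v w n → Walk u w (m + n)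
nil ++ʷ w₂ = w₂
cons step w₁ ++ʷ w₂ = cons step (w₁ ++ʷ w₂)

walk-end : ∀ {u v w n} → v ≡ w → Walk u v n → Walk u w n
walk-end refl w = w

-- If no grid
-- edge raises f by more than one, f grows by at most m along any walk of
-- length m; a walk along which f grows by exactly its length is therefore
-- a shortest path.

Functional : Set
Functional = ℤ × ℤ

ev : Functional → V → ℤ
ev (α , β) (x , y) = α *ℤ x +ℤ β *ℤ y

ev-⊕ : ∀ f u w → ev f (u ⊕ w) ≡ ev f u +ℤ ev f w
ev-⊕ (α , β) (x , y) (z , t) = linear α β x y z t
  where
  linear : ∀ α β x y z t →
    α *ℤ (x +ℤ z) +ℤ β *ℤ (y +ℤ t) ≡ (α *ℤ x +ℤ β *ℤ y) +ℤ (α *ℤ z +ℤ β *ℤ t)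
  linear = solve-∀

record Lipschitz (f : Functional) : Set where
  constructor lipschitz
  field bounded : ∀ d → ev f (δ d) ≤ℤ + 1
open Lipschitz

lipschitz? : ∀ f → Dec (Lipschitz f)
lipschitz? f = map′ from-checks to-checks
  (check +i ×-dec check -i ×-dec check +j ×-dec check -j ×-dec check +k ×-dec check -k)
  where
  check : ∀ d → Dec (ev f (δ d) ≤ℤ + 1)
  check d = ev f (δ d) ≤ℤ? + 1
  Checks : Set
  Checks = ev f (δ +i) ≤ℤ + 1 × ev f (δ -i) ≤ℤ + 1 × ev f (δ +j) ≤ℤ + 1 ×
           ev f (δ -j) ≤ℤ + 1 × ev f (δ +k) ≤ℤ + 1 × ev f (δ -k) ≤ℤ + 1
  from-checks : Checks → Lipschitz f
  from-checks (p₁ , p₂ , p₃ , p₄ , p₅ , p₆) = lipschitz λ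
    { +i → p₁ ; -i → p₂ ; +j → p₃ ; -j → p₄ ; +k → p₅ ; -k → p₆ }
  to-checks : Lipschitz f → Checks
  to-checks (lipschitz L) = L +i , L -i , L +j , L -j , L +k , L -k

+ℤ-cancelˡ-≤ : ∀ c {a b} → c +ℤ a ≤ℤ c +ℤ b → a ≤ℤ b
+ℤ-cancelˡ-≤ c {a} {b} le = subst₂ _≤ℤ_ (undo a) (undo b) (ℤP.+-monoʳ-≤ (ℤ.- c) le)
  where
  undo : ∀ x → ℤ.- c +ℤ (c +ℤ x) ≡ x
  undo x = lemma c x
    where
    lemma : ∀ c x → ℤ.- c +ℤ (c +ℤ x) ≡ x
    lemma = solve-∀

walk-bound : ∀ {f} → Lipschitz f → ∀ {u v m} → Walk u v m → ev f v ≤ℤ ev f u +ℤ + m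
walk-bound {f} lip {u} nil = ℤP.≤-reflexive (sym (ℤP.+-identityʳ (ev f u)))
walk-bound {f} lip {u} {v} (cons {n = n} (d , refl) w) = begin
  ev f v                               ≤⟨ walk-bound lip w ⟩
  ev f (u ⊕ δ d) +ℤ + n                ≡⟨ cong (_+ℤ + n) (ev-⊕ f u (δ d)) ⟩
  ev f u +ℤ ev f (δ d) +ℤ + n          ≤⟨ ℤP.+-monoˡ-≤ (+ n) (ℤP.+-monoʳ-≤ (ev f u) (bounded lip d)) ⟩
  ev f u +ℤ + 1 +ℤ + n                 ≡⟨ ℤP.+-assoc (ev f u) (+ 1) (+ n) ⟩
  ev f u +ℤ + suc n                    ∎
  where open ℤP.≤-Reasoning

ev-mv : ∀ f d → ev f (δ d) ≡ + 1 → ∀ u n → ev f (mv u d n) ≡ ev f u +ℤ + n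
ev-mv f d unit u zero = sym (ℤP.+-identityʳ (ev f u))
ev-mv f d unit u (suc n) = begin
  ev f (mv (u ⊕ δ d) d n)        ≡⟨ ev-mv f d unit (u ⊕ δ d) n ⟩
  ev f (u ⊕ δ d) +ℤ + n          ≡⟨ cong (_+ℤ + n) (ev-⊕ f u (δ d)) ⟩
  ev f u +ℤ ev f (δ d) +ℤ + n    ≡⟨ cong (λ z → ev f u +ℤ z +ℤ + n) unit ⟩
  ev f u +ℤ + 1 +ℤ + n           ≡⟨ ℤP.+-assoc (ev f u) (+ 1) (+ n) ⟩
  ev f u +ℤ + suc n              ∎
  where open ≡-Reasoning

dist-min : ∀ {u v n m} → Dist u v n → Walk u v m → n ≤ m
dist-min {n = n} {m} (_ , minimal) w with n ℕ.≤? m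
... | yes n≤m = n≤m
... | no n≰m = ⊥-elim (minimal m (ℕP.≰⇒> n≰m) w)

certified-shortest : ∀ {f u v n} → Lipschitz f → Walk u v n → ev f v ≡ ev f u +ℤ + n → Dist u v n
certified-shortest {f} {u} {v} {n} lip w tight = w , shorter-impossible
  where
  shorter-impossible : ∀ m → m < n → ¬ Walk u v m
  shorter-impossible m m<n w′ = ℕP.<⇒≱ m<n (ℤP.drop‿+≤+ (+ℤ-cancelˡ-≤ (ev f u)
    (subst (_≤ℤ ev f u +ℤ + m) tight (walk-bound lip w′))))

second-leg : ∀ {P : V → Set} {u v w m n} (w₁ : Walk u v m) (w₂ : Walk v w n) →
  All P (walkVerts (w₁ ++ʷ w₂)) → All P (walkVerts w₂)
second-leg nil w₂ all = all
second-leg (cons _ w₁) w₂ (_ ∷ all) = second-leg w₁ w₂ all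

first-vertex : ∀ {P : V → Set} {u v n} (w : Walk u v n) → All P (walkVerts w) → P u
first-vertex nil (p ∷ _) = p
first-vertex (cons _ _) (p ∷ _) = p

convex-between : ∀ {S : V → Set} → Convex S → ∀ {u v x n m₁ m₂} → S u → S v → Dist u v n →
  Walk u x m₁ → Walk x v m₂ → m₁ + m₂ ≡ n → S x
convex-between convex su sv dist w₁ w₂ refl =
  first-vertex w₂ (second-leg w₁ w₂ (convex (w₁ ++ʷ w₂) su sv dist))

-- Sectors: every displacement is a nonnegative combination of two
-- directions 60° apart, one "early" direction (+i, +j, -k), moved along
-- first, and one "late" direction (+k, -i, -j), moved along second.
-- The two legs form a shortest path, certified by a functional that is 1
-- on both directions.

data Early : Dir → Set where
  early+i : Early +i
  early+j : Early +j
  early-k : Early -k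

data Late : Dir → Set where
  late+k : Late +k
  late-i : Late -i
  late-j : Late -j

early∩late : ∀ {d} → Early d → Late d → ⊥
early∩late early+i ()
early∩late early+j ()
early∩late early-k ()

record Sector (s e : Dir) : Set where
  field
    early        : Early s
    late         : Late e
    certificate  : Functional
    certified    : Lipschitz certificate
    tight-first  : ev certificate (δ s) ≡ + 1
    tight-second : ev certificate (δ e) ≡ + 1

two-leg-dist : ∀ {s e} → Sector s e → ∀ X a b → Dist X (mv (mv X s a) e b) (a + b)
two-leg-dist {s} {e} S X a b =
  certified-shortest certified (line X s a ++ʷ line (mv X s a) e b) (begin
    ev f (mv (mv X s a) e b)    ≡⟨ ev-mv f e tight-second (mv X s a) b ⟩
    ev f (mv X s a) +ℤ + b      ≡⟨ cong (_+ℤ + b) (ev-mv f s tight-first X a) ⟩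
    ev f X +ℤ + a +ℤ + b        ≡⟨ ℤP.+-assoc (ev f X) (+ a) (+ b) ⟩
    ev f X +ℤ + (a + b)         ∎)
  where
  open Sector S
  f : Functional
  f = certificate
  open ≡-Reasoning

sector-+i+k : Sector +i +k
sector-+i+k = record { early = early+i ; late = late+k ; certificate = (+ 1 , + 0)
  ; certified = from-yes (lipschitz? (+ 1 , + 0)) ; tight-first = refl ; tight-second = refl }

sector-+j+k : Sector +j +k
sector-+j+k = record { early = early+j ; late = late+k ; certificate = (+ 0 , + 1)
  ; certified = from-yes (lipschitz? (+ 0 , + 1)) ; tight-first = refl ; tight-second = refl }

sector-+j-i : Sector +j -i
sector-+j-i = record { early = early+j ; late = late-i ; certificate = (-[1+ 0 ] , + 1)
  ; certified = from-yes (lipschitz? (-[1+ 0 ] , + 1)) ; tight-first = refl ; tight-second = refl }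

sector--k-i : Sector -k -i
sector--k-i = record { early = early-k ; late = late-i ; certificate = (-[1+ 0 ] , + 0)
  ; certified = from-yes (lipschitz? (-[1+ 0 ] , + 0)) ; tight-first = refl ; tight-second = refl }

sector--k-j : Sector -k -j
sector--k-j = record { early = early-k ; late = late-j ; certificate = (+ 0 , -[1+ 0 ])
  ; certified = from-yes (lipschitz? (+ 0 , -[1+ 0 ])) ; tight-first = refl ; tight-second = refl }

sector-+i-j : Sector +i -j
sector-+i-j = record { early = early+i ; late = late-j ; certificate = (+ 1 , -[1+ 0 ])
  ; certified = from-yes (lipschitz? (+ 1 , -[1+ 0 ])) ; tight-first = refl ; tight-second = refl }

record Decomposition (D : V) : Set where
  field
    {first second} : Dir
    sector         : Sector first second
    len₁ len₂      : ℕ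
    splits         : D ≡ len₁ · δ first ⊕ len₂ · δ second

in-sector : ∀ {s e D} → Sector s e → ∀ a b → D ≡ a · δ s ⊕ b · δ e → Decomposition D
in-sector S a b eq = record { sector = S ; len₁ = a ; len₂ = b ; splits = eq }

private
  module Coordinates where
    sum : ∀ A B → A +ℤ B ≡ A *ℤ + 1 +ℤ B *ℤ + 1
    sum = solve-∀
    left : ∀ A B → A ≡ A *ℤ + 1 +ℤ B *ℤ + 0
    left = solve-∀
    right : ∀ A B → B ≡ A *ℤ + 0 +ℤ B *ℤ + 1
    right = solve-∀
    neg-sum : ∀ A B → ℤ.- (A +ℤ B) ≡ A *ℤ -[1+ 0 ] +ℤ B *ℤ -[1+ 0 ]
    neg-sum = solve-∀
    neg-left : ∀ A B → ℤ.- A ≡ A *ℤ -[1+ 0 ] +ℤ B *ℤ + 0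
    neg-left = solve-∀
    neg-right : ∀ A B → ℤ.- B ≡ A *ℤ + 0 +ℤ B *ℤ -[1+ 0 ]
    neg-right = solve-∀
  open Coordinates

decompose : ∀ D → Decomposition D
decompose (+ m , + n) with ℕP.≤-total n m
... | inj₁ n≤m = in-sector sector-+i+k (m ∸ n) n (cong₂ _,_
      (trans (cong +_ (sym (ℕP.m∸n+n≡m n≤m))) (sum (+ (m ∸ n)) (+ n))) (right (+ (m ∸ n)) (+ n)))
... | inj₂ m≤n = in-sector sector-+j+k (n ∸ m) m (cong₂ _,_
      (right (+ (n ∸ m)) (+ m)) (trans (cong +_ (sym (ℕP.m∸n+n≡m m≤n))) (sum (+ (n ∸ m)) (+ m))))
decompose (+ m , -[1+ n ]) = in-sector sector-+i-j m (suc n) (cong₂ _,_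
  (left (+ m) (+ suc n)) (neg-right (+ m) (+ suc n)))
decompose (-[1+ m ] , + n) = in-sector sector-+j-i n (suc m) (cong₂ _,_
  (neg-right (+ n) (+ suc m)) (left (+ n) (+ suc m)))
decompose (-[1+ m ] , -[1+ n ]) with ℕP.≤-total n m
... | inj₁ n≤m = in-sector sector--k-i (suc n) (m ∸ n) (cong₂ _,_
      (trans (cong -[1+_] (sym (ℕP.m+[n∸m]≡n n≤m))) (neg-sum (+ suc n) (+ (m ∸ n))))
      (neg-left (+ suc n) (+ (m ∸ n))))
... | inj₂ m≤n = in-sector sector--k-j (suc m) (n ∸ m) (cong₂ _,_
      (neg-left (+ suc m) (+ (n ∸ m)))
      (trans (cong -[1+_] (sym (ℕP.m+[n∸m]≡n m≤n))) (neg-sum (+ suc m) (+ (n ∸ m)))))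

record Route (o t : V) : Set where
  field
    {first second} : Dir
    sector         : Sector first second
    len₁ len₂      : ℕ
    reaches        : t ≡ mv (mv o first len₁) second len₂

route : ∀ o t → Route o t
route o t = record { sector = sector ; len₁ = len₁ ; len₂ = len₂ ; reaches = reaches }
  where
  open Decomposition (decompose (t ⊖ o))
  open ≡-Reasoning
  reaches : t ≡ mv (mv o first len₁) second len₂
  reaches = begin
    t                                          ≡⟨ sym (⊕-⊖ o t) ⟩
    o ⊕ (t ⊖ o)                                ≡⟨ cong (o ⊕_) splits ⟩
    o ⊕ (len₁ · δ first ⊕ len₂ · δ second)     ≡⟨ sym (⊕-assoc o _ _) ⟩
    (o ⊕ len₁ · δ first) ⊕ len₂ · δ second     ≡⟨ sym (mv-closed _ second len₂) ⟩
    mv (o ⊕ len₁ · δ first) second len₂        ≡⟨ cong (λ x → mv x second len₂) (sym (mv-closed o first len₁)) ⟩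
    mv (mv o first len₁) second len₂           ∎

route-dist : ∀ {o t} (r : Route o t) → Dist o t (Route.len₁ r + Route.len₂ r)
route-dist {o} r = subst (λ t → Dist o t (len₁ + len₂)) (sym reaches) (two-leg-dist sector o len₁ len₂)
  where open Route r

-- Time is divided into rounds of two steps: in round τ, packets
-- moving in a positive direction (+i, +j, +k) may move at step 2τ, packets
-- moving in a negative direction at step 2τ+1.

negative : Dir → Bool
negative +i = false
negative +j = false
negative +k = false
negative -i = true
negative -j = true
negative -k = true

negative-reverse : ∀ d → negative (reverse d) ≡ not (negative d)
negative-reverse +i = refl
negative-reverse -i = refl
negative-reverse +j = refl
negative-reverse -j = refl
negative-reverse +k = refl
negative-reverse -k = refl

slot : Bool → ℕ → ℕ
slot false τ = τ + τ
slot true  τ = suc (τ + τ)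

-- done b t: the number of rounds whose b-slot lies before time t.
done : Bool → ℕ → ℕ
done false t = ⌈ t /2⌉
done true  t = ⌊ t /2⌋

round-of-slot : ∀ b τ → ⌊ slot b τ /2⌋ ≡ τ
round-of-slot false τ = sym (ℕP.n≡⌊n+n/2⌋ τ)
round-of-slot true  τ = sym (ℕP.n≡⌈n+n/2⌉ τ)

slot-injective : ∀ b b′ {τ τ′} → slot b τ ≡ slot b′ τ′ → b ≡ b′ × τ ≡ τ′
slot-injective b b′ {τ} {τ′} eq = same-sign b b′ (subst (λ σ → slot b τ ≡ slot b′ σ) (sym same-round) eq) , same-round
  where
  same-round : τ ≡ τ′
  same-round = trans (sym (round-of-slot b τ)) (trans (cong ⌊_/2⌋ eq) (round-of-slot b′ τ′))
  same-sign : ∀ b b′ → slot b τ ≡ slot b′ τ → b ≡ b′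
  same-sign false false _ = refl
  same-sign true  true  _ = refl
  same-sign false true  eq = ⊥-elim (ℕP.1+n≢n (sym eq))
  same-sign true  false eq = ⊥-elim (ℕP.1+n≢n eq)

half-step : ∀ t → ⌊ suc t /2⌋ ≡ ⌊ t /2⌋ ⊎ (t ≡ slot true ⌊ t /2⌋ × ⌊ suc t /2⌋ ≡ suc ⌊ t /2⌋)
half-step zero = inj₁ refl
half-step (suc zero) = inj₂ (refl , refl)
half-step (suc (suc t)) with half-step t
... | inj₁ same = inj₁ (cong suc same)
... | inj₂ (odd , up) =
  inj₂ (cong (λ n → suc (suc n)) (trans odd (sym (ℕP.+-suc ⌊ t /2⌋ ⌊ t /2⌋))) , cong suc up)

done-step : ∀ b t → done b (suc t) ≡ done b t ⊎ (t ≡ slot b (done b t) × done b (suc t) ≡ suc (done b t))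
done-step true t = half-step t
done-step false t with half-step (suc t)
... | inj₁ same = inj₁ same
... | inj₂ (odd , up) = inj₂ (ℕP.suc-injective odd , up)

done-mono : ∀ b t → done b t ≤ done b (suc t)
done-mono b t with done-step b t
... | inj₁ same = ℕP.≤-reflexive (sym same)
... | inj₂ (_ , up) = ℕP.≤-trans (ℕP.n≤1+n _) (ℕP.≤-reflexive (sym up))

floor≤done : ∀ b t → ⌊ t /2⌋ ≤ done b t
floor≤done false t = ℕP.⌊n/2⌋≤⌈n/2⌉ t
floor≤done true t = ℕP.≤-refl

done≤ceil : ∀ b t → done b t ≤ ⌈ t /2⌉
done≤ceil false t = ℕP.≤-refl
done≤ceil true t = ℕP.⌊n/2⌋≤⌈n/2⌉ t

done-at-slot : ∀ b b′ τ → τ ≤ done b′ (slot b τ)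
done-at-slot b b′ τ = subst (_≤ done b′ (slot b τ)) (round-of-slot b τ) (floor≤done b′ (slot b τ))

done-after-slot : ∀ b b′ τ → done b′ (suc (slot b τ)) ≤ suc τ
done-after-slot b b′ τ = subst (done b′ (suc (slot b τ)) ≤_) (cong suc (round-of-slot b τ))
  (done≤ceil b′ (suc (slot b τ)))

done-close : ∀ b b′ t → done b t ≤ suc (done b′ t)
done-close b b′ t = begin
  done b t          ≤⟨ done≤ceil b t ⟩
  ⌊ suc t /2⌋       ≤⟨ ℕP.⌊n/2⌋-mono (ℕP.n≤1+n (suc t)) ⟩
  suc ⌊ t /2⌋       ≤⟨ s≤s (floor≤done b′ t) ⟩
  suc (done b′ t)   ∎
  where open ℕP.≤-Reasoning

done-end : ∀ b L → done b (2 * L) ≡ L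
done-end b L = trans (cong (λ n → done b (L + n)) (ℕP.+-identityʳ L)) (halves b)
  where
  halves : ∀ b → done b (L + L) ≡ L
  halves false = sym (ℕP.n≡⌈n+n/2⌉ L)
  halves true = sym (ℕP.n≡⌊n+n/2⌋ L)

-- progress lo n b t: how many of the n rounds lo, …, lo+n-1 have had their
-- b-slot before time t.
progress : ℕ → ℕ → Bool → ℕ → ℕ
progress lo n b t = n ⊓ (done b t ∸ lo)

progress-before : ∀ lo n b t → done b t ≤ lo → progress lo n b t ≡ 0
progress-before lo n b t le = trans (cong (n ⊓_) (ℕP.m≤n⇒m∸n≡0 le)) (ℕP.⊓-zeroʳ n)

progress-after : ∀ lo n b t → lo + n ≤ done b t → progress lo n b t ≡ n
progress-after lo n b t le =
  ℕP.m≤n⇒m⊓n≡m (ℕP.≤-trans (ℕP.≤-reflexive (sym (ℕP.m+n∸m≡n lo n))) (ℕP.∸-monoˡ-≤ lo le))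

progress-≤ : ∀ lo n b t → progress lo n b t ≤ n
progress-≤ lo n b t = ℕP.m⊓n≤m n _

record Advance (lo n : ℕ) (b : Bool) (t : ℕ) : Set where
  field
    round   : ℕ
    at-slot : t ≡ slot b round
    from    : lo ≤ round
    below   : round < lo + n
    before  : progress lo n b t ≡ round ∸ lo
    after   : progress lo n b (suc t) ≡ suc (round ∸ lo)

progress-step : ∀ lo n b t → progress lo n b (suc t) ≡ progress lo n b t ⊎ Advance lo n b t
progress-step lo n b t with done-step b t
... | inj₁ same = inj₁ (cong (λ r → n ⊓ (r ∸ lo)) same)
... | inj₂ (at , up) with ℕP.<-≤-connex (done b t) lo
...   | inj₁ early = inj₁ (trans
        (progress-before lo n b (suc t) (ℕP.≤-trans (ℕP.≤-reflexive up) early))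
        (sym (progress-before lo n b t (ℕP.<⇒≤ early))))
...   | inj₂ lo≤τ with ℕP.<-≤-connex (done b t) (lo + n)
...     | inj₂ late = inj₁ (trans
          (progress-after lo n b (suc t) (ℕP.≤-trans late (done-mono b t)))
          (sym (progress-after lo n b t late)))
...     | inj₁ τ<hi = inj₂ (record
          { round = τ ; at-slot = at ; from = lo≤τ ; below = τ<hi
          ; before = ℕP.m≥n⇒m⊓n≡n (ℕP.<⇒≤ inside)
          ; after = trans (cong (λ r → n ⊓ (r ∸ lo)) up)
                      (trans (cong (n ⊓_) (ℕP.+-∸-assoc 1 lo≤τ)) (ℕP.m≥n⇒m⊓n≡n inside)) })
  where
  τ : ℕ
  τ = done b t
  inside : τ ∸ lo < n
  inside = ℕP.≤-trans (ℕP.∸-monoˡ-< τ<hi lo≤τ) (ℕP.≤-reflexive (ℕP.m+n∸m≡n lo n))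

-- A packet with origin o and destination t that
-- moves at step `now` does so in the slot of some round; during its early
-- phase it then sits `round` steps from o, during its late phase it still
-- has L ∸ round steps to go to t.
record Move (o t : V) (L : ℕ) (p : ℕ → V) (now : ℕ) : Set where
  field
    dir     : Dir
    round   : ℕ
    at-slot : now ≡ slot (negative dir) round
    next    : p (suc now) ≡ p now ⊕ δ dir
    phase   : (Early dir × p now ≡ mv o dir round) ⊎ (Late dir × t ≡ mv (p now) dir (L ∸ round))

-- In the same orientation they
-- have the same direction and round, hence (phases being disjoint) pin down
-- the origin or the destination; in opposite orientations their directions
-- have opposite signs, which own different slots.
moves-compatible : ∀ {o₁ t₁ o₂ t₂ L p₁ p₂ now} → Move o₁ t₁ L p₁ now → Move o₂ t₂ L p₂ now →
  SameEdge (p₁ now) (p₁ (suc now)) (p₂ now) (p₂ (suc now)) → o₁ ≡ o₂ ⊎ t₁ ≡ t₂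
moves-compatible {o₁} {t₁} {o₂} {t₂} {L} {p₁} {p₂} {now} m₁ m₂ (inj₁ (here , there)) =
  compare (Move.phase m₁) (Move.phase m₂)
  where
  open Move m₁ renaming (dir to d₁; round to r₁)
  open Move m₂ renaming (dir to d₂; round to r₂; next to next₂; at-slot to at-slot₂)
  same-dir : d₁ ≡ d₂
  same-dir = δ-injective (⊕-cancelˡ (p₁ now)
    (trans (sym next) (trans there (trans next₂ (cong (_⊕ δ d₂) (sym here))))))
  same-round : r₁ ≡ r₂
  same-round = proj₂ (slot-injective (negative d₁) (negative d₂) (trans (sym at-slot) at-slot₂))
  compare : (Early d₁ × p₁ now ≡ mv o₁ d₁ r₁) ⊎ (Late d₁ × t₁ ≡ mv (p₁ now) d₁ (L ∸ r₁)) →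
            (Early d₂ × p₂ now ≡ mv o₂ d₂ r₂) ⊎ (Late d₂ × t₂ ≡ mv (p₂ now) d₂ (L ∸ r₂)) →
            o₁ ≡ o₂ ⊎ t₁ ≡ t₂
  compare (inj₁ (_ , at₁)) (inj₁ (_ , at₂)) = inj₁ (mv-cancel d₂ r₂
    (trans (cong₂ (mv o₁) (sym same-dir) (sym same-round)) (trans (sym at₁) (trans here at₂))))
  compare (inj₁ (early , _)) (inj₂ (late , _)) = ⊥-elim (early∩late (subst Early same-dir early) late)
  compare (inj₂ (late , _)) (inj₁ (early , _)) = ⊥-elim (early∩late early (subst Late same-dir late))
  compare (inj₂ (_ , to₁)) (inj₂ (_ , to₂)) = inj₂ (trans to₁ (trans
    (cong₂ (λ x d → mv x d (L ∸ r₁)) here same-dir)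
    (trans (cong (λ r → mv (p₂ now) d₂ (L ∸ r)) same-round) (sym to₂))))
moves-compatible {p₁ = p₁} {p₂} {now} m₁ m₂ (inj₂ (here , there)) =
  ⊥-elim (not-¬ refl (trans same-sign (trans (cong negative reversed) (negative-reverse d₁))))
  where
  open Move m₁ renaming (dir to d₁)
  open Move m₂ renaming (dir to d₂; next to next₂; at-slot to at-slot₂)
  same-sign : negative d₁ ≡ negative d₂
  same-sign = proj₁ (slot-injective (negative d₁) (negative d₂) (trans (sym at-slot) at-slot₂))
  back-and-forth : p₁ now ⊕ (δ d₁ ⊕ δ d₂) ≡ p₁ now ⊕ 𝟎
  back-and-forth = begin
    p₁ now ⊕ (δ d₁ ⊕ δ d₂)     ≡⟨ sym (⊕-assoc (p₁ now) (δ d₁) (δ d₂)) ⟩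
    (p₁ now ⊕ δ d₁) ⊕ δ d₂     ≡⟨ cong (_⊕ δ d₂) (trans (sym next) there) ⟩
    p₂ now ⊕ δ d₂              ≡⟨ sym next₂ ⟩
    p₂ (suc now)               ≡⟨ sym here ⟩
    p₁ now                     ≡⟨ sym (⊕-identityʳ (p₁ now)) ⟩
    p₁ now ⊕ 𝟎                 ∎
    where open ≡-Reasoning
  reversed : d₂ ≡ reverse d₁
  reversed = δ-injective (⊕-cancelˡ (δ d₁)
    (trans (⊕-cancelˡ (p₁ now) back-and-forth) (sym (δ-reverse d₁))))

window-split : ∀ lo b τ → lo ≤ τ → τ ≤ lo + b → (τ ∸ lo) + ((lo + b) ∸ τ) ≡ b
window-split lo b τ lo≤τ τ≤hi = begin
  c + ((lo + b) ∸ τ)          ≡⟨ cong (λ x → c + ((lo + b) ∸ x)) (sym (ℕP.m+[n∸m]≡n lo≤τ)) ⟩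
  c + ((lo + b) ∸ (lo + c))   ≡⟨ cong (λ n → c + n) (ℕP.[m+n]∸[m+o]≡n∸o lo b c) ⟩
  c + (b ∸ c)                 ≡⟨ ℕP.m+[n∸m]≡n c≤b ⟩
  b                           ∎
  where
  open ≡-Reasoning
  c : ℕ
  c = τ ∸ lo
  c≤b : c ≤ b
  c≤b = ℕP.m≤n+o⇒m∸n≤o τ lo τ≤hi

-- The schedule of a single packet following route r in L rounds: it moves
-- along its early direction in rounds 0, …, len₁-1 and along its late
-- direction in the last len₂ rounds L-len₂, …, L-1, each time in the slot
-- belonging to the sign of the direction.
module PacketSchedule {o t : V} (r : Route o t) (L : ℕ) (fits : Route.len₁ r + Route.len₂ r ≤ L) where
  open Route r renaming (first to s; second to e; len₁ to a; len₂ to b)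

  lo : ℕ
  lo = L ∸ b

  lo+b≡L : lo + b ≡ L
  lo+b≡L = ℕP.m∸n+n≡m (ℕP.≤-trans (ℕP.m≤n+m b a) fits)

  a≤lo : a ≤ lo
  a≤lo = ℕP.+-cancelʳ-≤ b a lo (ℕP.≤-trans fits (ℕP.≤-reflexive (sym lo+b≡L)))

  early-steps late-steps : ℕ → ℕ
  early-steps = progress 0 a (negative s)
  late-steps = progress lo b (negative e)

  pos : ℕ → V
  pos now = mv (mv o s (early-steps now)) e (late-steps now)

  pos-start : pos 0 ≡ o
  pos-start = cong₂ (λ x y → mv (mv o s x) e y)
    (progress-before 0 a (negative s) 0 (done≤ceil (negative s) 0))
    (progress-before lo b (negative e) 0 (ℕP.≤-trans (done≤ceil (negative e) 0) z≤n))

  pos-end : pos (2 * L) ≡ t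
  pos-end = trans (cong₂ (λ x y → mv (mv o s x) e y)
    (progress-after 0 a (negative s) (2 * L)
      (subst (a ≤_) (sym (done-end (negative s) L)) (ℕP.≤-trans (ℕP.m≤m+n a b) fits)))
    (progress-after lo b (negative e) (2 * L)
      (subst (lo + b ≤_) (sym (done-end (negative e) L)) (ℕP.≤-reflexive lo+b≡L))))
    (sym reaches)

  dist-early : ∀ x → x ≤ a → Dist (mv o s x) t ((a ∸ x) + b)
  dist-early x x≤a = subst (λ y → Dist (mv o s x) y ((a ∸ x) + b))
    (trans (cong (λ z → mv z e b) (trans (mv-+ o s x (a ∸ x)) (cong (mv o s) (ℕP.m+[n∸m]≡n x≤a))))
           (sym reaches))
    (two-leg-dist sector (mv o s x) (a ∸ x) b)

  dist-late : ∀ y → y ≤ b → Dist (mv (mv o s a) e y) t (b ∸ y)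
  dist-late y y≤b = subst (λ z → Dist (mv (mv o s a) e y) z (b ∸ y))
    (trans (trans (mv-+ (mv o s a) e y (b ∸ y)) (cong (mv (mv o s a) e) (ℕP.m+[n∸m]≡n y≤b)))
           (sym reaches))
    (two-leg-dist sector (mv (mv o s a) e y) 0 (b ∸ y))

  phases : ∀ now → early-steps now ≡ a ⊎ late-steps now ≡ 0
  phases now with done (negative e) now ℕ.≤? lo
  ... | yes quiet = inj₂ (progress-before lo b (negative e) now quiet)
  ... | no started = inj₁ (progress-after 0 a (negative s) now (ℕP.≤-trans a≤lo
    (ℕP.≤-pred (ℕP.≤-trans (ℕP.≰⇒> started) (done-close (negative e) (negative s) now)))))

  inside : ∀ {S : V → Set} → Convex S → S o → S t → ∀ now → S (pos now)
  inside {S} convex so st now with phases now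
  ... | inj₂ late-idle = subst S (cong (mv (mv o s x) e) (sym late-idle))
        (convex-between convex so st (route-dist r) (line o s x) (proj₁ (dist-early x x≤a))
          (trans (sym (ℕP.+-assoc x (a ∸ x) b)) (cong (_+ b) (ℕP.m+[n∸m]≡n x≤a))))
    where
    x : ℕ
    x = early-steps now
    x≤a : x ≤ a
    x≤a = progress-≤ 0 a (negative s) now
  ... | inj₁ early-done = subst S (cong (λ z → mv (mv o s z) e y) (sym early-done))
        (convex-between convex so st (route-dist r) (line o s a ++ʷ line (mv o s a) e y)
          (proj₁ (dist-late y y≤b))
          (trans (ℕP.+-assoc a y (b ∸ y)) (cong (λ n → a + n) (ℕP.m+[n∸m]≡n y≤b))))
    where
    y : ℕ
    y = late-steps now
    y≤b : y ≤ b
    y≤b = progress-≤ lo b (negative e) now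

  Closer : ℕ → Set
  Closer now = ∃[ n ] (Dist (pos (suc now)) t n × Dist (pos now) t (suc n))

  early-move : ∀ {now} → Advance 0 a (negative s) now → Move o t L pos now × Closer now
  early-move {now} adv = move , (a ∸ suc τ) + b ,
      subst (λ z → Dist z t _) (sym pos-after) (dist-early (suc τ) below) ,
      subst₂ (λ z n → Dist z t n) (sym pos-before) (cong (_+ b) (ℕP.+-∸-assoc 1 below))
        (dist-early τ (ℕP.<⇒≤ below))
    where
    open Advance adv renaming (round to τ)
    late-idle : done (negative e) (suc now) ≤ lo
    late-idle = ℕP.≤-trans
      (subst (λ u → done (negative e) (suc u) ≤ suc τ) (sym at-slot) (done-after-slot (negative s) (negative e) τ))
      (ℕP.≤-trans below a≤lo)
    pos-before : pos now ≡ mv o s τ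
    pos-before = cong₂ (λ x y → mv (mv o s x) e y) before
      (progress-before lo b (negative e) now (ℕP.≤-trans (done-mono (negative e) now) late-idle))
    pos-after : pos (suc now) ≡ mv o s (suc τ)
    pos-after = cong₂ (λ x y → mv (mv o s x) e y) after (progress-before lo b (negative e) (suc now) late-idle)
    move : Move o t L pos now
    move = record { dir = s ; round = τ ; at-slot = at-slot
      ; next = trans pos-after (trans (mv-suc o s τ) (cong (_⊕ δ s) (sym pos-before)))
      ; phase = inj₁ (Sector.early sector , pos-before) }

  late-move : ∀ {now} → early-steps (suc now) ≡ early-steps now → Advance lo b (negative e) now →
    Move o t L pos now × Closer now
  late-move {now} early-same adv = move , b ∸ suc c ,
      subst (λ z → Dist z t _) (sym pos-after) (dist-late (suc c) c<b) ,
      subst₂ (λ z n → Dist z t n) (sym pos-before) (ℕP.+-∸-assoc 1 c<b) (dist-late c (ℕP.<⇒≤ c<b))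
    where
    open Advance adv renaming (round to τ)
    c : ℕ
    c = τ ∸ lo
    c<b : c < b
    c<b = ℕP.+-cancelˡ-< lo c b (subst (_< lo + b) (sym (ℕP.m+[n∸m]≡n from)) below)
    early-done : early-steps now ≡ a
    early-done = progress-after 0 a (negative s) now (ℕP.≤-trans a≤lo (ℕP.≤-trans from
      (subst (τ ≤_) (cong (done (negative s)) (sym at-slot)) (done-at-slot (negative e) (negative s) τ))))
    pos-before : pos now ≡ mv (mv o s a) e c
    pos-before = cong₂ (λ x y → mv (mv o s x) e y) early-done before
    pos-after : pos (suc now) ≡ mv (mv o s a) e (suc c)
    pos-after = cong₂ (λ x y → mv (mv o s x) e y) (trans early-same early-done) after
    remaining : t ≡ mv (pos now) e (L ∸ τ)
    remaining = begin
      t                                       ≡⟨ reaches ⟩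
      mv (mv o s a) e b                       ≡⟨ cong (mv (mv o s a) e) (sym (window-split lo b τ from (ℕP.<⇒≤ below))) ⟩
      mv (mv o s a) e (c + ((lo + b) ∸ τ))    ≡⟨ sym (mv-+ (mv o s a) e c _) ⟩
      mv (mv (mv o s a) e c) e ((lo + b) ∸ τ) ≡⟨ cong₂ (λ x n → mv x e (n ∸ τ)) (sym pos-before) lo+b≡L ⟩
      mv (pos now) e (L ∸ τ)                  ∎
      where open ≡-Reasoning
    move : Move o t L pos now
    move = record { dir = e ; round = τ ; at-slot = at-slot
      ; next = trans pos-after (trans (mv-suc (mv o s a) e c) (cong (_⊕ δ e) (sym pos-before)))
      ; phase = inj₂ (Sector.late sector , remaining) }

  step : ∀ now → pos (suc now) ≡ pos now ⊎ (Move o t L pos now × Closer now)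
  step now with progress-step 0 a (negative s) now
  ... | inj₂ adv = inj₂ (early-move adv)
  ... | inj₁ early-same with progress-step lo b (negative e) now
  ...   | inj₂ adv = inj₂ (late-move early-same adv)
  ...   | inj₁ late-same = inj₁ (cong₂ (λ x y → mv (mv o s x) e y) early-same late-same)

maxOf : ∀ {k} → (Fin k → ℕ) → ℕ
maxOf {zero} f = 0
maxOf {suc k} f = f zero ⊔ maxOf (f ∘ suc)

≤-maxOf : ∀ {k} (f : Fin k → ℕ) i → f i ≤ maxOf f
≤-maxOf f zero = ℕP.m≤m⊔n _ _
≤-maxOf f (suc i) = ℕP.≤-trans (≤-maxOf (f ∘ suc) i) (ℕP.m≤n⊔m _ _)

maxOf-≤ : ∀ {k} (f : Fin k → ℕ) B → (∀ i → f i ≤ B) → maxOf f ≤ B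
maxOf-≤ {zero} f B bounded = z≤n
maxOf-≤ {suc k} f B bounded = ℕP.⊔-lub (bounded zero) (maxOf-≤ (f ∘ suc) B (bounded ∘ suc))

module Routing (S : V → Set) (convex : Convex S) (k : ℕ) (I : Instance k) (perm : IsPermutation S I) where
  routes : ∀ i → Route (origin I i) (dest I i)
  routes i = route (origin I i) (dest I i)

  route-length : Fin k → ℕ
  route-length i = Route.len₁ (routes i) + Route.len₂ (routes i)

  rounds : ℕ
  rounds = maxOf route-length

  module P (i : Fin k) = PacketSchedule (routes i) rounds (≤-maxOf route-length i)

  schedule : Schedule k
  schedule i = P.pos i

  moves : ∀ i now → Adj (schedule i now) (schedule i (suc now)) → Move (origin I i) (dest I i) rounds (schedule i) now
  moves i now adj with P.step i now
  ... | inj₁ stay = ⊥-elim (adj-irreflexive (schedule i now) (subst (Adj (schedule i now)) stay adj))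
  ... | inj₂ (move , _) = move

  half-duplex : ∀ i j now → i ≢ j →
    Adj (schedule i now) (schedule i (suc now)) → Adj (schedule j now) (schedule j (suc now)) →
    ¬ SameEdge (schedule i now) (schedule i (suc now)) (schedule j now) (schedule j (suc now))
  half-duplex i j now i≢j adjᵢ adjⱼ same =
    i≢j (same-packet (moves-compatible (moves i now adjᵢ) (moves j now adjⱼ) same))
    where
    same-packet : origin I i ≡ origin I j ⊎ dest I i ≡ dest I j → i ≡ j
    same-packet (inj₁ eq) = proj₁ perm eq
    same-packet (inj₂ eq) = proj₁ (proj₂ perm) eq

  shortest : ShortestPathRouting I schedule
  shortest i now with P.step i now
  ... | inj₁ stay = inj₁ stay
  ... | inj₂ (move , closer) = inj₂ ((Move.dir move , Move.next move) , closer)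

  valid : ValidSchedule S I schedule (2 * rounds)
  valid = P.pos-start
        , (λ i → P.inside i convex (origins-inside i) (destinations-inside i))
        , (λ i now → map₂ proj₁ (shortest i now))
        , half-duplex
        , P.pos-end
    where
    origins-inside : ∀ i → S (origin I i)
    origins-inside = proj₁ (proj₂ (proj₂ perm))
    destinations-inside : ∀ i → S (dest I i)
    destinations-inside = proj₂ (proj₂ (proj₂ perm))

algorithm : Algorithm
algorithm S convex k I perm = 2 * rounds , schedule , valid , shortest
  where open Routing S convex k I perm

within-twice-max-distance : ∀ (S : V → Set) (c : Convex S) k (I : Instance k) (h : IsPermutation S I) L →
  DistBoundedBy I L → runTime algorithm S c k I h ≤ 2 * L
within-twice-max-distance S c k I h L bounded =
  ℕP.*-monoʳ-≤ 2 (maxOf-≤ route-length L (λ i → bounded i _ (route-dist (routes i))))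
  where open Routing S c k I h

-- (iii) Any valid schedule needs at least ℓmax steps, so the algorithm is
-- a 2-approximation.

snoc : ∀ {u v w m} → Walk u v m → Adj v w → Walk u w (suc m)
snoc nil adj = cons adj nil
snoc (cons step w) adj = cons step (snoc w adj)

travelled : ∀ {S k} {I : Instance k} {q T} → ValidSchedule S I q T →
  ∀ i now → Σ ℕ λ m → m ≤ now × Walk (q i 0) (q i now) m
travelled {S} valid i zero = 0 , z≤n , nil
travelled {S} {q = q} valid@(_ , _ , steps , _) i (suc now) with travelled {S} valid i now | steps i now
... | m , m≤now , w | inj₁ stay = m , ℕP.m≤n⇒m≤1+n m≤now , subst (λ x → Walk (q i 0) x m) (sym stay) w
... | m , m≤now , w | inj₂ adj = suc m , s≤s m≤now , snoc w adj

distances-below-makespan : ∀ {S k} {I : Instance k} {q T} → ValidSchedule S I q T → DistBoundedBy I T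
distances-below-makespan {S} {T = T} valid@(starts , _ , _ , _ , ends) i n dist with travelled {S} valid i T
... | m , m≤T , w = ℕP.≤-trans (dist-min dist (subst₂ (λ x y → Walk x y m) (starts i) (ends i) w)) m≤T

within-twice-optimal : ∀ (S : V → Set) (c : Convex S) k (I : Instance k) (h : IsPermutation S I)
  (q : Schedule k) (T′ : ℕ) → ValidSchedule S I q T′ → runTime algorithm S c k I h ≤ 2 * T′
within-twice-optimal S c k I h q T′ valid =
  within-twice-max-distance S c k I h T′ (distances-below-makespan {S} valid)

-- On the x-axis, ℓ packets travel east from 0, …, ℓ-1 to
-- ℓ, …, 2ℓ-1 and ℓ packets travel west from ℓ, …, 2ℓ-1 to 0, …, ℓ-1.
-- A shortest path between two axis points never leaves the axis, so every
-- packet traverses the edge {ℓ-1, ℓ}; half-duplex edges carry one packet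
-- per step, so 2ℓ steps are needed.

tight-step : ∀ {f P D m n d} → Lipschitz f → ev f D ≡ ev f P +ℤ + m → suc n ≤ m →
  Walk (P ⊕ δ d) D n → + 1 ≤ℤ ev f (δ d)
tight-step {f} {P} {D} {m} {n} {d} lip tight n<m w =
  +ℤ-cancelˡ-≤ (+ n) (+ℤ-cancelˡ-≤ (ev f P) (begin
    ev f P +ℤ (+ n +ℤ + 1)          ≡⟨ cong (ev f P +ℤ_) (ℤP.+-comm (+ n) (+ 1)) ⟩
    ev f P +ℤ + suc n               ≤⟨ ℤP.+-monoʳ-≤ (ev f P) (+≤+ n<m) ⟩
    ev f P +ℤ + m                   ≡⟨ sym tight ⟩
    ev f D                          ≤⟨ walk-bound lip w ⟩
    ev f (P ⊕ δ d) +ℤ + n           ≡⟨ cong (_+ℤ + n) (ev-⊕ f P (δ d)) ⟩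
    ev f P +ℤ ev f (δ d) +ℤ + n     ≡⟨ ℤP.+-assoc (ev f P) (ev f (δ d)) (+ n) ⟩
    ev f P +ℤ (ev f (δ d) +ℤ + n)   ≡⟨ cong (ev f P +ℤ_) (ℤP.+-comm (ev f (δ d)) (+ n)) ⟩
    ev f P +ℤ (+ n +ℤ ev f (δ d))   ∎))
  where open ℤP.≤-Reasoning

ax : ℕ → V
ax c = (+ c , + 0)

ax-injective : ∀ {c c′} → ax c ≡ ax c′ → c ≡ c′
ax-injective eq = ℤP.+-injective (cong proj₁ eq)

east-line : ∀ c m → mv (ax c) +i m ≡ ax (c + m)
east-line c zero = cong ax (sym (ℕP.+-identityʳ c))
east-line c (suc m) = trans (east-line (c + 1) m) (cong ax (ℕP.+-assoc c 1 m))

west-line : ∀ z m → mv (ax (m + z)) -i m ≡ ax z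
west-line z zero = refl
west-line z (suc m) = west-line z m

-- The functionals tight on +i (those of the sectors (+i,+k) and (+i,-j))
-- grow eastwards along the axis; those tight on -i grow westwards.
east-tight : ∀ β c m → ev (+ 1 , β) (ax (c + m)) ≡ ev (+ 1 , β) (ax c) +ℤ + m
east-tight β c m = lemma β (+ c) (+ m)
  where
  lemma : ∀ β C M → + 1 *ℤ (C +ℤ M) +ℤ β *ℤ + 0 ≡ (+ 1 *ℤ C +ℤ β *ℤ + 0) +ℤ M
  lemma = solve-∀

west-tight : ∀ β z m → ev (-[1+ 0 ] , β) (ax z) ≡ ev (-[1+ 0 ] , β) (ax (m + z)) +ℤ + m
west-tight β z m = lemma β (+ z) (+ m)
  where
  lemma : ∀ β Z M → -[1+ 0 ] *ℤ Z +ℤ β *ℤ + 0 ≡ (-[1+ 0 ] *ℤ (M +ℤ Z) +ℤ β *ℤ + 0) +ℤ M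
  lemma = solve-∀

east-forced : ∀ {c m n d} → Walk (ax c ⊕ δ d) (ax (c + m)) n → suc n ≤ m → d ≡ +i
east-forced {c} {m} {d = d} w n<m = forced
  (tight-step {P = ax c} {d = d} (Sector.certified sector-+i+k) (east-tight (+ 0) c m) n<m w)
  (tight-step {P = ax c} {d = d} (Sector.certified sector-+i-j) (east-tight -[1+ 0 ] c m) n<m w)
  where
  forced : ∀ {d} → + 1 ≤ℤ ev (+ 1 , + 0) (δ d) → + 1 ≤ℤ ev (+ 1 , -[1+ 0 ]) (δ d) → d ≡ +i
  forced {+i} _ _ = refl
  forced { -i} () _
  forced {+j} _ ()
  forced { -j} (+≤+ ()) _
  forced {+k} _ (+≤+ ())
  forced { -k} () _

west-forced : ∀ {z m n d} → Walk (ax (m + z) ⊕ δ d) (ax z) n → suc n ≤ m → d ≡ -i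
west-forced {z} {m} {d = d} w n<m = forced
  (tight-step {P = ax (m + z)} {d = d} (Sector.certified sector--k-i) (west-tight (+ 0) z m) n<m w)
  (tight-step {P = ax (m + z)} {d = d} (Sector.certified sector-+j-i) (west-tight (+ 1) z m) n<m w)
  where
  forced : ∀ {d} → + 1 ≤ℤ ev (-[1+ 0 ] , + 0) (δ d) → + 1 ≤ℤ ev (-[1+ 0 ] , + 1) (δ d) → d ≡ -i
  forced {+i} () _
  forced { -i} _ _ = refl
  forced {+j} (+≤+ ()) _
  forced { -j} _ ()
  forced {+k} () _
  forced { -k} _ (+≤+ ())

east-progress : ∀ {c z Q n} → c ≤ z → Adj (ax c) Q → Dist Q (ax z) n → Dist (ax c) (ax z) (suc n) →
  Q ≡ ax (suc c)
east-progress {c} {z} c≤z (d , refl) (w , _) dist =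
  trans (cong (λ d → ax c ⊕ δ d) (east-forced {d = d} (walk-end there w) (dist-min dist straight)))
        (cong ax (ℕP.+-comm c 1))
  where
  there : ax z ≡ ax (c + (z ∸ c))
  there = cong ax (sym (ℕP.m+[n∸m]≡n c≤z))
  straight : Walk (ax c) (ax z) (z ∸ c)
  straight = walk-end (trans (east-line c _) (sym there)) (line (ax c) +i _)

west-progress : ∀ {c z Q n} → z ≤ c → Adj (ax (suc c)) Q → Dist Q (ax z) n → Dist (ax (suc c)) (ax z) (suc n) →
  Q ≡ ax c
west-progress {c} {z} {n = n} z≤c (d , refl) (w , _) dist =
  cong (λ d → ax (suc c) ⊕ δ d) (west-forced {d = d} (subst (λ x → Walk (ax x ⊕ δ d) (ax z) n) here w) (dist-min dist straight))
  where
  here : suc c ≡ suc (c ∸ z) + z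
  here = cong suc (sym (ℕP.m∸n+n≡m z≤c))
  straight : Walk (ax (suc c)) (ax z) (suc (c ∸ z))
  straight = subst (λ x → Walk (ax x) (ax z) (suc (c ∸ z))) (sym here) (walk-end (west-line z (suc (c ∸ z))) (line (ax (suc (c ∸ z) + z)) -i (suc (c ∸ z))))

first-exit : (P Exit : ℕ → Set) → (∀ t → P t → P (suc t) ⊎ Exit t) →
  ∀ T → P 0 → ¬ P T → Σ ℕ λ t → t < T × Exit t
first-exit P Exit step zero p₀ ¬p = ⊥-elim (¬p p₀)
first-exit P Exit step (suc T) p₀ ¬p with step 0 p₀
... | inj₂ exit = 0 , s≤s z≤n , exit
... | inj₁ p₁ with first-exit (P ∘ suc) (Exit ∘ suc) (step ∘ suc) T p₁ ¬p
...   | t , t<T , exit = suc t , s≤s t<T , exit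

ShortestTrajectory : (ℕ → V) → V → Set
ShortestTrajectory q D = ∀ t → q (suc t) ≡ q t ⊎
  (Adj (q t) (q (suc t)) × ∃[ n ] (Dist (q (suc t)) D n × Dist (q t) D (suc n)))

crosses-east : ∀ L (q : ℕ → V) {c z T} → ShortestTrajectory q (ax z) → q 0 ≡ ax c → q T ≡ ax z →
  c ≤ L → L < z → Σ ℕ λ t → t < T × (q t ≡ ax L × q (suc t) ≡ ax (suc L))
crosses-east L q {c} {z} {T} shortest start end c≤L L<z =
  first-exit West Exit step T (c , c≤L , start) not-west
  where
  West Exit : ℕ → Set
  West t = Σ ℕ λ c → c ≤ L × q t ≡ ax c
  Exit t = q t ≡ ax L × q (suc t) ≡ ax (suc L)
  step : ∀ t → West t → West (suc t) ⊎ Exit t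
  step t (c , c≤L , at) with shortest t
  ... | inj₁ stay = inj₁ (c , c≤L , trans stay at)
  ... | inj₂ (adj , n , closer , dist) = arrive c≤L at (east-progress (ℕP.≤-trans c≤L (ℕP.<⇒≤ L<z))
          (subst (λ x → Adj x (q (suc t))) at adj) closer (subst (λ x → Dist x (ax z) (suc n)) at dist))
    where
    arrive : ∀ {c} → c ≤ L → q t ≡ ax c → q (suc t) ≡ ax (suc c) → West (suc t) ⊎ Exit t
    arrive {c} c≤L at next with c ℕ.≟ L
    ... | yes refl = inj₂ (at , next)
    ... | no c≢L = inj₁ (suc c , ℕP.≤∧≢⇒< c≤L c≢L , next)
  not-west : ¬ West T
  not-west (c , c≤L , at) = ℕP.<⇒≱ L<z (subst (_≤ L) (ax-injective (trans (sym at) end)) c≤L)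

crosses-west : ∀ L (q : ℕ → V) {c z T} → ShortestTrajectory q (ax z) → q 0 ≡ ax (suc c) → q T ≡ ax z →
  L ≤ c → z ≤ L → Σ ℕ λ t → t < T × (q t ≡ ax (suc L) × q (suc t) ≡ ax L)
crosses-west L q {c} {z} {T} shortest start end L≤c z≤L =
  first-exit East Exit step T (c , L≤c , start) not-east
  where
  East Exit : ℕ → Set
  East t = Σ ℕ λ c → L ≤ c × q t ≡ ax (suc c)
  Exit t = q t ≡ ax (suc L) × q (suc t) ≡ ax L
  step : ∀ t → East t → East (suc t) ⊎ Exit t
  step t (c , L≤c , at) with shortest t
  ... | inj₁ stay = inj₁ (c , L≤c , trans stay at)
  ... | inj₂ (adj , n , closer , dist) = arrive L≤c at (west-progress (ℕP.≤-trans z≤L L≤c)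
          (subst (λ x → Adj x (q (suc t))) at adj) closer (subst (λ x → Dist x (ax z) (suc n)) at dist))
    where
    arrive : ∀ {c} → L ≤ c → q t ≡ ax (suc c) → q (suc t) ≡ ax c → East (suc t) ⊎ Exit t
    arrive {c} L≤c at next with ℕP.m≤n⇒m<n∨m≡n L≤c
    ... | inj₂ refl = inj₂ (at , next)
    ... | inj₁ (s≤s {n = c′} L≤c′) = inj₁ (c′ , L≤c′ , next)
  not-east : ¬ East T
  not-east (c , L≤c , at) =
    ℕP.<⇒≱ (s≤s L≤c) (subst (_≤ L) (sym (ax-injective (trans (sym at) end))) z≤L)

Traverses : V → V → (ℕ → V) → ℕ → Set
Traverses A B q t = (q t ≡ A × q (suc t) ≡ B) ⊎ (q t ≡ B × q (suc t) ≡ A)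

-- Under half-duplex each step carries at most one packet over a given edge;
-- so if each of k packets traverses the same edge before time T, then k ≤ T.
edge-congestion : ∀ {S k} {I : Instance k} {p T A B} → ValidSchedule S I p T → Adj A B → Adj B A →
  (∀ i → Σ ℕ λ t → t < T × Traverses A B (p i) t) → k ≤ T
edge-congestion {k = k} {p = p} {T} {A} {B} (_ , _ , _ , half-duplex , _) ab ba traversal =
  FinP.injective⇒≤ time-injective
  where
  time : Fin k → Fin T
  time i = fromℕ< (proj₁ (proj₂ (traversal i)))
  uses-edge : ∀ i t → Traverses A B (p i) t → Adj (p i t) (p i (suc t))
  uses-edge i t (inj₁ (at , next)) = subst₂ Adj (sym at) (sym next) ab
  uses-edge i t (inj₂ (at , next)) = subst₂ Adj (sym at) (sym next) ba
  same-edge : ∀ i j t → Traverses A B (p i) t → Traverses A B (p j) t →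
    SameEdge (p i t) (p i (suc t)) (p j t) (p j (suc t))
  same-edge i j t (inj₁ (a , b)) (inj₁ (c , d)) = inj₁ (trans a (sym c) , trans b (sym d))
  same-edge i j t (inj₁ (a , b)) (inj₂ (c , d)) = inj₂ (trans a (sym d) , trans b (sym c))
  same-edge i j t (inj₂ (a , b)) (inj₁ (c , d)) = inj₂ (trans a (sym d) , trans b (sym c))
  same-edge i j t (inj₂ (a , b)) (inj₂ (c , d)) = inj₁ (trans a (sym c) , trans b (sym d))
  clash : ∀ {i j} → i ≢ j → (tᵢ : Σ ℕ λ t → t < T × Traverses A B (p i) t)
    (tⱼ : Σ ℕ λ t → t < T × Traverses A B (p j) t) → proj₁ tᵢ ≢ proj₁ tⱼ
  clash {i} {j} i≢j (t , _ , xᵢ) (.t , _ , xⱼ) refl =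
    half-duplex i j t i≢j (uses-edge i t xᵢ) (uses-edge j t xⱼ) (same-edge i j t xᵢ xⱼ)
  time-injective : ∀ {i j} → time i ≡ time j → i ≡ j
  time-injective {i} {j} eq with i Fin.≟ j
  ... | yes i≡j = i≡j
  ... | no i≢j = ⊥-elim (clash i≢j (traversal i) (traversal j) (trans
    (sym (FinP.toℕ-fromℕ< _)) (trans (cong toℕ eq) (FinP.toℕ-fromℕ< _))))

-- The lower-bound instance for ℓmax = ℓ = L + 1.
module Tight (L : ℕ) where
  ℓ : ℕ
  ℓ = suc L

  -- Eastbound packets inj₁ x travel from x to x + ℓ, westbound packets
  -- inj₂ y from ℓ + y to y.
  Packet : Set
  Packet = Fin ℓ ⊎ Fin ℓ

  start finish : Packet → ℕ
  start (inj₁ x) = toℕ x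
  start (inj₂ y) = ℓ + toℕ y
  finish (inj₁ x) = toℕ x + ℓ
  finish (inj₂ y) = toℕ y

  k : ℕ
  k = ℓ + ℓ

  packet : Fin k → Packet
  packet = splitAt ℓ

  hard-instance : Instance k
  hard-instance = record { origin = ax ∘ start ∘ packet ; dest = ax ∘ finish ∘ packet }

  packet-injective : ∀ {i j} → packet i ≡ packet j → i ≡ j
  packet-injective {i} {j} eq =
    trans (sym (FinP.join-splitAt ℓ ℓ i)) (trans (cong (Fin.join ℓ ℓ) eq) (FinP.join-splitAt ℓ ℓ j))

  low≢high : ∀ (x : Fin ℓ) n → toℕ x ≢ ℓ + n
  low≢high x n eq = ℕP.<⇒≱ (FinP.toℕ<n x) (ℕP.≤-trans (ℕP.m≤m+n ℓ n) (ℕP.≤-reflexive (sym eq)))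

  start-injective : ∀ g h → start g ≡ start h → g ≡ h
  start-injective (inj₁ x) (inj₁ y) eq = cong inj₁ (FinP.toℕ-injective eq)
  start-injective (inj₁ x) (inj₂ y) eq = ⊥-elim (low≢high x (toℕ y) eq)
  start-injective (inj₂ x) (inj₁ y) eq = ⊥-elim (low≢high y (toℕ x) (sym eq))
  start-injective (inj₂ x) (inj₂ y) eq = cong inj₂ (FinP.toℕ-injective (ℕP.+-cancelˡ-≡ ℓ _ _ eq))

  finish-injective : ∀ g h → finish g ≡ finish h → g ≡ h
  finish-injective (inj₁ x) (inj₁ y) eq = cong inj₁ (FinP.toℕ-injective (ℕP.+-cancelʳ-≡ ℓ _ _ eq))
  finish-injective (inj₁ x) (inj₂ y) eq = ⊥-elim (low≢high y (toℕ x) (trans (sym eq) (ℕP.+-comm (toℕ x) ℓ)))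
  finish-injective (inj₂ x) (inj₁ y) eq = ⊥-elim (low≢high x (toℕ y) (trans eq (ℕP.+-comm (toℕ y) ℓ)))
  finish-injective (inj₂ x) (inj₂ y) eq = cong inj₂ (FinP.toℕ-injective eq)

  permutation : IsPermutation FullGrid hard-instance
  permutation = (λ eq → packet-injective (start-injective _ _ (ax-injective eq)))
              , (λ eq → packet-injective (finish-injective _ _ (ax-injective eq)))
              , (λ _ → tt) , (λ _ → tt)

  packet-dist : ∀ g → Dist (ax (start g)) (ax (finish g)) ℓ
  packet-dist (inj₁ x) = certified-shortest (Sector.certified sector-+i+k)
    (walk-end (east-line (toℕ x) ℓ) (line (ax (toℕ x)) +i ℓ)) (east-tight (+ 0) (toℕ x) ℓ)
  packet-dist (inj₂ y) = certified-shortest (Sector.certified sector--k-i)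
    (walk-end (west-line (toℕ y) ℓ) (line (ax (ℓ + toℕ y)) -i ℓ)) (west-tight (+ 0) (toℕ y) ℓ)

  max-distance : MaxDist hard-instance ℓ
  max-distance = (λ i n dist → dist-min dist (proj₁ (packet-dist (packet i))))
               , zero , packet-dist (packet zero)

  traverses : ∀ (p : Schedule k) T → ValidSchedule FullGrid hard-instance p T →
    ShortestPathRouting hard-instance p → ∀ i → Σ ℕ λ t → t < T × Traverses (ax L) (ax ℓ) (p i) t
  traverses p T (starts , _ , _ , _ , ends) shortest i = crossing (packet i) (shortest i) (starts i) (ends i)
    where
    crossing : ∀ g → ShortestTrajectory (p i) (ax (finish g)) → p i 0 ≡ ax (start g) → p i T ≡ ax (finish g) →
      Σ ℕ λ t → t < T × Traverses (ax L) (ax ℓ) (p i) t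
    crossing (inj₁ x) towards start end with crosses-east L (p i) towards start end
      (ℕP.≤-pred (FinP.toℕ<n x)) (ℕP.m≤n+m ℓ (toℕ x))
    ... | t , t<T , crossing = t , t<T , inj₁ crossing
    crossing (inj₂ y) towards start end with crosses-west L (p i) towards start end
      (ℕP.m≤m+n L (toℕ y)) (ℕP.≤-pred (FinP.toℕ<n y))
    ... | t , t<T , crossing = t , t<T , inj₂ crossing

  lower-bound : ∀ (p : Schedule k) T → ValidSchedule FullGrid hard-instance p T →
    ShortestPathRouting hard-instance p → 2 * ℓ ≤ T
  lower-bound p T valid shortest = subst (_≤ T) (cong (λ n → ℓ + n) (sym (ℕP.+-identityʳ ℓ)))
    (edge-congestion valid (+i , cong ax (ℕP.+-comm 1 L)) (-i , refl) (traverses p T valid shortest))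

mainTheorem1 :
    Σ Algorithm (λ A →
      (∀ (S : V → Set) (c : Convex S) k (I : Instance k) (h : IsPermutation S I) L →
         DistBoundedBy I L → runTime A S c k I h ≤ 2 * L) ×
      (∀ (S : V → Set) (c : Convex S) k (I : Instance k) (h : IsPermutation S I)
         (q : Schedule k) (T′ : ℕ) →
         ValidSchedule S I q T′ → runTime A S c k I h ≤ 2 * T′)) ×
    (∀ (L : ℕ) → Σ ℕ λ k → Σ (Instance k) λ I →
       IsPermutation FullGrid I × MaxDist I (suc L) ×
       (∀ (p : Schedule k) (T : ℕ) → ValidSchedule FullGrid I p T →
          ShortestPathRouting I p → 2 * suc L ≤ T))
mainTheorem1 =
  (algorithm , within-twice-max-distance , within-twice-optimal) ,
  λ L → let open Tight L in k , hard-instance , permutation , max-distance , lower-bound
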